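{- Let $G$ be a random graph drawn from the distribution $\mathcal{G}$ described in the context, and let $M_{j^\star}$ be its special induced matching. Then: (i) $\mathbb{E}[\mu(G)]\ge (N-r)\cdot 2k+2r\cdot(k-1)+r/2$; (ii) with probability one, $\mu(G\setminus M_{j^\star})\le (N-r)\cdot 2k+2r\cdot(k-1)$, where $G\setminus M_{j^\star}$ is $G$ with the edges of $M_{j^\star}$ removed.
   Context: Let $N$ be an integer, $r:=N/3$, $t:=N^{1+\Omega(1/\log\log N)}$, and $k:=2\lceil\log_{4/3}N\rceil+1$ (an odd integer $>1$). A matching $M$ of a graph is induced if no edge of the graph joins two vertices matched by $M$ other than the edges of $M$ themselves. An $(r,t)$-Ruzsa–Szemerédi graph is a graph whose edge set is the disjoint union of $t$ induced matchings $M_1,\dots,M_t$, each of size $r$. Let $G^{\mathrm{rs}}$ be a fixed bipartite $(r,t)$-Ruzsa–Szemerédi graph with $N$ vertices on each side and induced matchings $M_1,\dots,M_t$. XOR-gadget: for bits $x_1,\dots,x_k$, $G^{\mathrm{xor}}(x_1,\dots,x_k)$ is the graph on $2k$ vertices $s,a_1,b_1,\dots,a_{k-1},b_{k-1},t$ ($t$ the final vertex) with edges: $s$ adjacent to $a_1$ if $x_1=0$ and to $b_1$ otherwise; $t$ adjacent to $a_{k-1}$ if $x_k=0$ and to $b_{k-1}$ otherwise; for $2\le i\le k-1$, $a_{i-1},b_{i-1}$ adjacent to $a_i,b_i$ respectively if $x_i=0$, and to $b_i,a_i$ respectively if $x_i=1$. Distribution $\mathcal{G}$: (1) pick $j^\star\in[t]$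 uniformly at random; $M_{j^\star}$ is the special induced matching. (2) For every vertex $v$ of $G^{\mathrm{rs}}$, let $y_v=1$ if $v$ is matched by $M_{j^\star}$ and $y_v=0$ otherwise, and sample $(x_{v,1},\dots,x_{v,k})$ uniformly at random (independently over $v$) conditioned on $x_{v,1}\oplus\cdots\oplus x_{v,k}=y_v$. (3) For every vertex $v$ of $G^{\mathrm{rs}}$ attach a copy of the XOR-gadget $G^{\mathrm{xor}}(x_{v,1},\dots,x_{v,k})$ whose final vertex is identified with $v$, all gadgets being otherwise vertex-disjoint from each other and from $G^{\mathrm{rs}}$. (4) Independently drop each edge of $G^{\mathrm{rs}}$ with probability $1/2$. The resulting graph is $G$. $\mu(\cdot)$ denotes maximum matching size. -}

module Defs where

open import Data.Nat using (ℕ; zero; suc; _+_; _*_; _∸_; _^_; _≤_)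
open import Data.Bool using (Bool; true; false; _xor_; _∧_; if_then_else_)
import Data.Bool.Properties as BoolP
open import Data.Fin using (Fin; toℕ; fromℕ; inject₁)
import Data.Fin as F
open import Data.Fin.Properties using (any?; all?)
open import Data.Product using (Σ; ∃; _×_; _,_; proj₁; proj₂)
open import Data.Sum using (_⊎_; inj₁; inj₂; [_,_])
open import Data.List using (List; []; _∷_; map; concatMap; length; allFin)
open import Data.Nat.ListAction using (sum)
open import Data.List.Relation.Unary.All using (All)
open import Data.List.Relation.Unary.Unique.Propositional using (Unique)
import Data.Vec.Functional as VF
open import Relation.Nullary using (¬_)
open import Relation.Nullary.Decidable using (⌊_⌋)
open import Relation.Binary.PropositionalEquality using (_≡_; _≢_)

-- A graph on vertex type V is given by an edge relation; edges are
-- undirected, i.e. {u,v} is an edge iff E u v or E v u.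
Graph : Set → Set₁
Graph V = V → V → Set

Adj : {V : Set} → Graph V → V → V → Set
Adj E u v = E u v ⊎ E v u

endpoints : {V : Set} → List (V × V) → List V
endpoints = concatMap (λ e → proj₁ e ∷ proj₂ e ∷ [])

IsMatching : {V : Set} → Graph V → List (V × V) → Set
IsMatching E ms = All (λ e → Adj E (proj₁ e) (proj₂ e)) ms × Unique (endpoints ms)

IsMaxMatchingSize : {V : Set} → Graph V → ℕ → Set
IsMaxMatchingSize E m =
  (Σ (List _) λ ms → IsMatching E ms × length ms ≡ m) ×
  (∀ ms → IsMatching E ms → length ms ≤ m)

-- Bipartite (r,t)-Ruzsa–Szemerédi graph with N vertices per side.
-- Edge set = disjoint union of the matchings M j (j : Fin t), each of
-- size r; M j i = (left endpoint , right endpoint) of its i-th edge.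

record RSGraph (N r t : ℕ) : Set where
  field
    M       : Fin t → Fin r → Fin N × Fin N
    injL    : ∀ j {i i'} → proj₁ (M j i) ≡ proj₁ (M j i') → i ≡ i'
    injR    : ∀ j {i i'} → proj₂ (M j i) ≡ proj₂ (M j i') → i ≡ i'
    disjoint : ∀ {j j' i i'} → M j i ≡ M j' i' → j ≡ j'
    induced : ∀ {j j' i i₁ i₂} →
              proj₁ (M j' i) ≡ proj₁ (M j i₁) →
              proj₂ (M j' i) ≡ proj₂ (M j i₂) → j' ≡ j

Side : ℕ → Set
Side N = Fin N ⊎ Fin N

-- XOR gadget with k = suc m bits x₁..x_k (x ℓ is the Fin index ℓ-1);
-- layers a_ℓ, b_ℓ for ℓ = 1..m (= k-1) are indexed by Fin m (index ℓ-1).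
-- 'tip' is the final vertex t (identified with the RS vertex).

data GV (m : ℕ) : Set where
  s   : GV m
  a   : Fin m → GV m
  b   : Fin m → GV m
  tip : GV m

data GEdge {m : ℕ} (x : Fin (suc m) → Bool) : GV m → GV m → Set where
  s-a : (i : Fin m) → toℕ i ≡ 0 → x F.zero ≡ false → GEdge x s (a i)
  s-b : (i : Fin m) → toℕ i ≡ 0 → x F.zero ≡ true  → GEdge x s (b i)
  a-t : (i : Fin m) → suc (toℕ i) ≡ m → x (fromℕ m) ≡ false → GEdge x (a i) tip
  b-t : (i : Fin m) → suc (toℕ i) ≡ m → x (fromℕ m) ≡ true  → GEdge x (b i) tip
  a-a : (i i' : Fin m) → toℕ i' ≡ suc (toℕ i) → x (inject₁ i') ≡ false → GEdge x (a i) (a i')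
  b-b : (i i' : Fin m) → toℕ i' ≡ suc (toℕ i) → x (inject₁ i') ≡ false → GEdge x (b i) (b i')
  a-b : (i i' : Fin m) → toℕ i' ≡ suc (toℕ i) → x (inject₁ i') ≡ true  → GEdge x (a i) (b i')
  b-a : (i i' : Fin m) → toℕ i' ≡ suc (toℕ i) → x (inject₁ i') ≡ true  → GEdge x (b i) (a i')

-- The graph G for an outcome (j⋆ , x , S) of the distribution:
--   x : bits of each vertex's gadget, S j i = true iff edge M j i is kept.

module _ {N r t m : ℕ} (rs : RSGraph N r t) where
  open RSGraph rs

  Vtx : Set
  Vtx = Side N × GV m

  data GE (x : Side N → Fin (suc m) → Bool) (S : Fin t → Fin r → Bool) : Vtx → Vtx → Set where
    gadget : ∀ {v p q} → GEdge (x v) p q → GE x S (v , p) (v , q)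
    rsEdge : ∀ j i → S j i ≡ true →
             GE x S (inj₁ (proj₁ (M j i)) , tip) (inj₂ (proj₂ (M j i)) , tip)

  GminusM : Fin t → (Side N → Fin (suc m) → Bool) → (Fin t → Fin r → Bool) → Graph Vtx
  GminusM j⋆ x S u v =
    GE x S u v × ¬ (∃ λ i → (u ≡ (inj₁ (proj₁ (M j⋆ i)) , tip)) × (v ≡ (inj₂ (proj₂ (M j⋆ i)) , tip)))

  yv : Fin t → Side N → Bool
  yv j (inj₁ u) = ⌊ any? (λ i → proj₁ (M j i) F.≟ u) ⌋
  yv j (inj₂ u) = ⌊ any? (λ i → proj₂ (M j i) F.≟ u) ⌋

  parity : {k : ℕ} → (Fin k → Bool) → Bool
  parity x = VF.foldr _xor_ false x

  -- the outcome lies in the support: every vertex's bits XOR to y_v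
  valid : Fin t → (Side N → Fin (suc m) → Bool) → Bool
  valid j x = ⌊ all? (λ u → parity (x (inj₁ u)) BoolP.≟ yv j (inj₁ u)) ⌋
            ∧ ⌊ all? (λ u → parity (x (inj₂ u)) BoolP.≟ yv j (inj₂ u)) ⌋

bools : List Bool
bools = false ∷ true ∷ []

allFuns : {A : Set} (n : ℕ) → List A → List (Fin n → A)
allFuns zero    xs = (λ ()) ∷ []
allFuns (suc n) xs = concatMap (λ y → map (λ g → y VF.∷ g) (allFuns n xs)) xs

sumOver : {A : Set} → List A → (A → ℕ) → ℕ
sumOver xs f = sum (map f xs)

-- Σ over all (j⋆ , x , S), with x uniform over ALL bit assignments and the
-- weight of an outcome being f applied to it; the conditional distribution
-- 𝒢 is obtained by restricting to valid outcomes (see 'expNum'/'expDen').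
sumOutcomes : (N r t m : ℕ) →
  (Fin t → (Side N → Fin (suc m) → Bool) → (Fin t → Fin r → Bool) → ℕ) → ℕ
sumOutcomes N r t m f =
  sumOver (allFin t) λ j →
  sumOver (allFuns N (allFuns (suc m) bools)) λ xL →
  sumOver (allFuns N (allFuns (suc m) bools)) λ xR →
  sumOver (allFuns t (allFuns r bools)) λ S →
  f j [ xL , xR ] S

-- 𝔼[f] = expNum f / expDen  (uniform j⋆, x uniform conditioned on the XOR
-- constraints, S uniform: every valid outcome has the same probability)
module _ {N r t m : ℕ} (rs : RSGraph N r t) where
  expNum : (Fin t → (Side N → Fin (suc m) → Bool) → (Fin t → Fin r → Bool) → ℕ) → ℕ
  expNum f = sumOutcomes N r t m (λ j x S → if valid rs j x then f j x S else 0)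

  expDen : ℕ
  expDen = sumOutcomes N r t m (λ j x S → if valid {m = m} rs j x then 1 else 0)

-- c = ⌈log_{4/3} N⌉ : least c with N ≤ (4/3)^c, i.e. N·3^c ≤ 4^c
IsCeilLog43 : ℕ → ℕ → Set
IsCeilLog43 N c = (N * 3 ^ c ≤ 4 ^ c) × (∀ c' → N * 3 ^ c' ≤ 4 ^ c' → c ≤ c')

-- In every gadget pick one vertex per layer, alternating along the gadget's two paths (which ones is
-- determined by the prefix XORs of its bits), together with the final vertex when the gadget's bits XOR to 0,
-- i.e. when that vertex is not matched by M j⋆. Since k - 1 is even this covers every gadget edge, and since
-- M j⋆ is induced it covers every other edge of G^rs. The cover has (2N - 2r) + 2N(k - 1) = (N - r)·2k + 2r(k - 1)
-- vertices, which gives (ii). Conversely each gadget has a matching saturating its part of the cover, and it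
-- leaves the final vertices matched by M j⋆ free, so together with the surviving edges of M j⋆ it is a matching
-- of G of size (N - r)·2k + 2r(k - 1) + #(surviving edges of M j⋆); each survives with probability 1/2, giving (i).

module Submission where

open import Defs
open import Data.Nat using (ℕ; zero; suc; _+_; _*_; _∸_; _≤_; z≤n; s≤s)
open import Data.Nat.Properties
open import Data.Nat.ListAction using (sum)
open import Data.Nat.ListAction.Properties using (sum-++)
open import Data.Nat.Solver using (module +-*-Solver)
open import Algebra.Properties.CommutativeSemigroup +-commutativeSemigroup using () renaming (interchange to +-interchange)
open import Algebra.Properties.CommutativeSemigroup *-commutativeSemigroup using () renaming (x∙yz≈y∙xz to *-swapˡ)
open import Data.Bool using (Bool; true; false; not; _∨_; _xor_; T; if_then_else_)
import Data.Bool as Bool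
open import Data.Bool.Properties using (T-≡; T-not-≡; T-∧; not-involutive; not-distribˡ-xor; xor-assoc; xor-identityʳ)
import Data.Vec.Functional as VF
open import Data.Fin using (Fin; toℕ; fromℕ; inject₁)
import Data.Fin as F
open import Data.Fin.Properties using (any?; all?; toℕ-inject₁; toℕ-fromℕ; toℕ-injective; toℕ<n)
open import Data.Product using (Σ; ∃; _×_; _,_; proj₁; proj₂)
open import Data.Product.Properties using (,-injective)
open import Data.Sum using (_⊎_; inj₁; inj₂; [_,_])
open import Data.Sum.Properties using (inj₁-injective; inj₂-injective)
open import Data.Empty using (⊥; ⊥-elim)
open import Data.List using (List; []; _∷_; map; concatMap; length; _++_; allFin; tabulate; cartesianProduct; filterᵇ)
open import Data.List.Properties using (map-++; map-∘; map-cong; map-tabulate; length-map; length-++; length-tabulate)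
open import Function.Definitions using (Injective)
open import Data.List.Relation.Unary.All as All using (All; []; _∷_)
import Data.List.Relation.Unary.All.Properties as All
open import Data.List.Relation.Unary.Any using (here; there)
open import Data.List.Relation.Unary.Unique.Propositional using (Unique; []; _∷_)
import Data.List.Relation.Unary.Unique.Propositional.Properties as Unique
open import Data.List.Membership.Propositional using (_∈_)
open import Data.List.Membership.Propositional.Properties
open import Function using (id; _∘_; Equivalence)
open import Relation.Nullary using (Dec; yes; no; does)
open import Relation.Nullary.Decidable using (⌊_⌋; T?; isYes≗does; dec-true; dec-false; toWitness)
open import Relation.Binary.PropositionalEquality hiding ([_])

bit : Bool → ℕ
bit false = 0
bit true  = 1

countᵇ : {A : Set} → (A → Bool) → List A → ℕ
countᵇ f xs = sumOver xs (bit ∘ f)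

module _ {A : Set} where

  sumOver-++ : (xs ys : List A) (f : A → ℕ) → sumOver (xs ++ ys) f ≡ sumOver xs f + sumOver ys f
  sumOver-++ xs ys f = trans (cong sum (map-++ f xs ys)) (sum-++ (map f xs) (map f ys))

  sumOver-cong : (xs : List A) {f g : A → ℕ} → (∀ a → f a ≡ g a) → sumOver xs f ≡ sumOver xs g
  sumOver-cong xs f≗g = cong sum (map-cong f≗g xs)

  sumOver-mono : (xs : List A) {f g : A → ℕ} → (∀ a → f a ≤ g a) → sumOver xs f ≤ sumOver xs g
  sumOver-mono []       f≤g = z≤n
  sumOver-mono (x ∷ xs) f≤g = +-mono-≤ (f≤g x) (sumOver-mono xs f≤g)

  sumOver-const : (xs : List A) (c : ℕ) → sumOver xs (λ _ → c) ≡ length xs * c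
  sumOver-const []       c = refl
  sumOver-const (x ∷ xs) c = cong (c +_) (sumOver-const xs c)

  sumOver-+ : (xs : List A) (f g : A → ℕ) → sumOver xs (λ a → f a + g a) ≡ sumOver xs f + sumOver xs g
  sumOver-+ []       f g = refl
  sumOver-+ (x ∷ xs) f g =
    trans (cong (f x + g x +_) (sumOver-+ xs f g)) (+-interchange (f x) (g x) _ _)

  sumOver-*ˡ : (xs : List A) (c : ℕ) (f : A → ℕ) → sumOver xs (λ a → c * f a) ≡ c * sumOver xs f
  sumOver-*ˡ []       c f = sym (*-zeroʳ c)
  sumOver-*ˡ (x ∷ xs) c f = trans (cong (c * f x +_) (sumOver-*ˡ xs c f)) (sym (*-distribˡ-+ c (f x) _))

  *-sumOver-mono : (xs : List A) (k l : ℕ) {f g : A → ℕ} → (∀ a → k * f a ≤ l * g a) →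
                   k * sumOver xs f ≤ l * sumOver xs g
  *-sumOver-mono xs k l {f} {g} kf≤lg = begin
    k * sumOver xs f          ≡⟨ sumOver-*ˡ xs k f ⟨
    sumOver xs (λ a → k * f a) ≤⟨ sumOver-mono xs kf≤lg ⟩
    sumOver xs (λ a → l * g a) ≡⟨ sumOver-*ˡ xs l g ⟩
    l * sumOver xs g          ∎
    where open ≤-Reasoning

sumOver-map : {A B : Set} (xs : List A) (g : A → B) (f : B → ℕ) → sumOver (map g xs) f ≡ sumOver xs (f ∘ g)
sumOver-map xs g f = cong sum (sym (map-∘ xs))

sumOver-concatMap : {A B : Set} (xs : List A) (g : A → List B) (f : B → ℕ) →
                    sumOver (concatMap g xs) f ≡ sumOver xs (λ a → sumOver (g a) f)
sumOver-concatMap []       g f = refl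
sumOver-concatMap (x ∷ xs) g f =
  trans (sumOver-++ (g x) (concatMap g xs) f) (cong (sumOver (g x) f +_) (sumOver-concatMap xs g f))

sumOver-cartesianProduct : {A B : Set} (xs : List A) (ys : List B) (f : A × B → ℕ) →
  sumOver (cartesianProduct xs ys) f ≡ sumOver xs (λ x → sumOver ys (λ y → f (x , y)))
sumOver-cartesianProduct []       ys f = refl
sumOver-cartesianProduct (x ∷ xs) ys f = begin
  sumOver (map (x ,_) ys ++ cartesianProduct xs ys) f
    ≡⟨ sumOver-++ (map (x ,_) ys) _ f ⟩
  sumOver (map (x ,_) ys) f + sumOver (cartesianProduct xs ys) f
    ≡⟨ cong₂ _+_ (sumOver-map ys (x ,_) f) (sumOver-cartesianProduct xs ys f) ⟩
  sumOver ys (λ y → f (x , y)) + sumOver xs (λ x → sumOver ys (λ y → f (x , y))) ∎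
  where open ≡-Reasoning

module _ {A : Set} where

  countᵇ-not : (f : A → Bool) (xs : List A) → countᵇ (not ∘ f) xs + countᵇ f xs ≡ length xs
  countᵇ-not f []       = refl
  countᵇ-not f (x ∷ xs) with f x
  ... | true  = trans (+-suc _ _) (cong suc (countᵇ-not f xs))
  ... | false = cong suc (countᵇ-not f xs)

  countᵇ-∨ : (f g : A → Bool) (xs : List A) → countᵇ (λ a → f a ∨ g a) xs ≤ countᵇ f xs + countᵇ g xs
  countᵇ-∨ f g []       = z≤n
  countᵇ-∨ f g (x ∷ xs) with f x | g x
  ... | true  | true  = s≤s (≤-trans (countᵇ-∨ f g xs) (≤-trans (n≤1+n _) (≤-reflexive (sym (+-suc _ _)))))
  ... | true  | false = s≤s (countᵇ-∨ f g xs)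
  ... | false | true  = ≤-trans (s≤s (countᵇ-∨ f g xs)) (≤-reflexive (sym (+-suc _ _)))
  ... | false | false = countᵇ-∨ f g xs

  countᵇ-false : (f : A → Bool) (xs : List A) → All (λ a → f a ≡ false) xs → countᵇ f xs ≡ 0
  countᵇ-false f []       []         = refl
  countᵇ-false f (x ∷ xs) (fx ∷ fxs) rewrite fx = countᵇ-false f xs fxs

  length-filterᵇ : (f : A → Bool) (xs : List A) → length (filterᵇ f xs) ≡ countᵇ f xs
  length-filterᵇ f []       = refl
  length-filterᵇ f (x ∷ xs) with f x
  ... | true  = cong suc (length-filterᵇ f xs)
  ... | false = length-filterᵇ f xs

  length≤countᵇ : (f : A → Bool) (ys ws : List A) → Unique ws →
                  All (λ w → f w ≡ true) ws → All (_∈ ys) ws → length ws ≤ countᵇ f ys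
  length≤countᵇ f ys []       _          _          _            = z≤n
  length≤countᵇ f ys (w ∷ ws) (w∉ws ∷ u) (fw ∷ fws) (w∈ys ∷ ws⊆ys) with ∈-∃++ w∈ys
  ... | us , vs , refl = begin
    suc (length ws)                ≤⟨ s≤s (length≤countᵇ f (us ++ vs) ws u fws (All.zipWith drop-w (w∉ws , ws⊆ys))) ⟩
    suc (countᵇ f (us ++ vs))      ≡⟨ cong suc (sumOver-++ us vs _) ⟩
    suc (countᵇ f us + countᵇ f vs) ≡⟨ +-suc _ _ ⟨
    countᵇ f us + suc (countᵇ f vs) ≡⟨ cong (λ c → countᵇ f us + (bit c + countᵇ f vs)) fw ⟨
    countᵇ f us + countᵇ f (w ∷ vs) ≡⟨ sumOver-++ us (w ∷ vs) _ ⟨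
    countᵇ f (us ++ w ∷ vs)        ∎
    where
    open ≤-Reasoning
    drop-w : ∀ {z} → w ≢ z × z ∈ us ++ w ∷ vs → z ∈ us ++ vs
    drop-w (w≢z , z∈) with ∈-++⁻ us z∈
    ... | inj₁ z∈us         = ∈-++⁺ˡ z∈us
    ... | inj₂ (here z≡w)   = ⊥-elim (w≢z (sym z≡w))
    ... | inj₂ (there z∈vs) = ∈-++⁺ʳ us z∈vs

isYes-true : {P : Set} (p? : Dec P) → P → ⌊ p? ⌋ ≡ true
isYes-true p? p = trans (isYes≗does p?) (dec-true p? p)

isYes-witness : {P : Set} (p? : Dec P) → ⌊ p? ⌋ ≡ true → P
isYes-witness p? is-yes = toWitness {a? = p?} (Equivalence.from T-≡ is-yes)

length-allFin : ∀ n → length (allFin n) ≡ n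
length-allFin n = length-tabulate {n = n} id

inImage : ∀ {n N} → (Fin n → Fin N) → Fin N → Bool
inImage f u = ⌊ any? (λ i → f i F.≟ u) ⌋

countᵇ-≟ : ∀ {N} (c : Fin N) (ys : List (Fin N)) → Unique ys → countᵇ (λ u → does (c F.≟ u)) ys ≤ 1
countᵇ-≟ c []       _          = z≤n
countᵇ-≟ c (y ∷ ys) (y∉ys ∷ u) with c F.≟ y
... | yes refl = s≤s (≤-reflexive (countᵇ-false _ ys (All.map (dec-false (c F.≟ _)) y∉ys)))
... | no  _    = countᵇ-≟ c ys u

countᵇ-inImage-≤ : ∀ {n N} (f : Fin n → Fin N) → countᵇ (inImage f) (allFin N) ≤ n
countᵇ-inImage-≤ {zero}  {N} f = ≤-reflexive (countᵇ-false _ (allFin N) (All.tabulate (λ _ → refl)))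
countᵇ-inImage-≤ {suc n} {N} f = begin
  countᵇ (inImage f) (allFin N)
    ≡⟨ sumOver-cong (allFin N) (λ u → cong bit (inImage-suc u)) ⟩
  countᵇ (λ u → does (f F.zero F.≟ u) ∨ inImage (f ∘ F.suc) u) (allFin N)
    ≤⟨ countᵇ-∨ _ _ (allFin N) ⟩
  countᵇ (λ u → does (f F.zero F.≟ u)) (allFin N) + countᵇ (inImage (f ∘ F.suc)) (allFin N)
    ≤⟨ +-mono-≤ (countᵇ-≟ (f F.zero) (allFin N) (Unique.allFin⁺ N)) (countᵇ-inImage-≤ (f ∘ F.suc)) ⟩
  suc n ∎
  where
  open ≤-Reasoning
  inImage-suc : ∀ u → inImage f u ≡ (does (f F.zero F.≟ u) ∨ inImage (f ∘ F.suc) u)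
  inImage-suc u with f F.zero F.≟ u | any? (λ i → f (F.suc i) F.≟ u)
  ... | yes _ | _     = refl
  ... | no  _ | yes _ = refl
  ... | no  _ | no  _ = refl

countᵇ-inImage-≥ : ∀ {n N} (f : Fin n → Fin N) → Injective _≡_ _≡_ f → n ≤ countᵇ (inImage f) (allFin N)
countᵇ-inImage-≥ {n} {N} f f-inj = begin
  n                             ≡⟨ length-tabulate f ⟨
  length (tabulate f)           ≤⟨ length≤countᵇ (inImage f) (allFin N) (tabulate f)
                                     (Unique.tabulate⁺ f-inj)
                                     (All.tabulate⁺ (λ i → isYes-true (any? _) (i , refl)))
                                     (All.tabulate⁺ (λ i → ∈-allFin (f i))) ⟩
  countᵇ (inImage f) (allFin N) ∎
  where open ≤-Reasoning

countᵇ-inImage : ∀ {n N} (f : Fin n → Fin N) → Injective _≡_ _≡_ f → countᵇ (inImage f) (allFin N) ≡ n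
countᵇ-inImage f f-inj = ≤-antisym (countᵇ-inImage-≤ f) (countᵇ-inImage-≥ f f-inj)

countᵇ-not-inImage : ∀ {n N} (f : Fin n → Fin N) → Injective _≡_ _≡_ f → countᵇ (not ∘ inImage f) (allFin N) + n ≡ N
countᵇ-not-inImage {n} {N} f f-inj = begin
  countᵇ (not ∘ inImage f) (allFin N) + n
    ≡⟨ cong (countᵇ (not ∘ inImage f) (allFin N) +_) (countᵇ-inImage f f-inj) ⟨
  countᵇ (not ∘ inImage f) (allFin N) + countᵇ (inImage f) (allFin N)
    ≡⟨ countᵇ-not (inImage f) (allFin N) ⟩
  length (allFin N)
    ≡⟨ length-allFin N ⟩
  N ∎
  where open ≡-Reasoning

endpoint : {V : Set} → Bool → V × V → V
endpoint false = proj₁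
endpoint true  = proj₂

module _ {V : Set} {E : Graph V} (cover : V → Bool)
         (covers : ∀ {u v} → E u v → cover u ≡ true ⊎ cover v ≡ true) where

  private
    covered-end : ∀ {u v} → Adj E u v → Σ V λ w → (w ≡ u ⊎ w ≡ v) × cover w ≡ true
    covered-end (inj₁ e) with covers e
    ... | inj₁ cu = _ , inj₁ refl , cu
    ... | inj₂ cv = _ , inj₂ refl , cv
    covered-end (inj₂ e) with covers e
    ... | inj₁ cv = _ , inj₂ refl , cv
    ... | inj₂ cu = _ , inj₁ refl , cu

    covered-ends : ∀ ms → All (λ e → Adj E (proj₁ e) (proj₂ e)) ms → Unique (endpoints ms) →
      Σ (List V) λ ws → length ws ≡ length ms × Unique ws ×
                        All (λ w → cover w ≡ true) ws × All (_∈ endpoints ms) ws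
    covered-ends []       []         []                              = [] , refl , [] , [] , []
    covered-ends (e ∷ ms) (adj ∷ adjs) ((_ ∷ u∉) ∷ (v∉ ∷ u)) with covered-ends ms adjs u | covered-end adj
    ... | ws , len , uws , cws , ws⊆ | w , w-end , cw =
      w ∷ ws , cong suc len , All.map (λ z∈ → w∉ w-end z∈) ws⊆ ∷ uws , cw ∷ cws ,
      w∈ w-end ∷ All.map (there ∘ there) ws⊆
      where
      w∉ : ∀ {z} → (w ≡ proj₁ e ⊎ w ≡ proj₂ e) → z ∈ endpoints ms → w ≢ z
      w∉ (inj₁ refl) z∈ = All.lookup u∉ z∈
      w∉ (inj₂ refl) z∈ = All.lookup v∉ z∈
      w∈ : (w ≡ proj₁ e ⊎ w ≡ proj₂ e) → w ∈ endpoints (e ∷ ms)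
      w∈ (inj₁ refl) = here refl
      w∈ (inj₂ refl) = there (here refl)

  matching≤cover : (vs : List V) → (∀ v → v ∈ vs) → ∀ ms → IsMatching E ms → length ms ≤ countᵇ cover vs
  matching≤cover vs complete ms (adjs , u) with covered-ends ms adjs u
  ... | ws , len , uws , cws , _ =
    subst (_≤ countᵇ cover vs) len (length≤countᵇ cover vs ws uws cws (All.tabulate (λ {w} _ → complete w)))

Unique-endpoints : {I V : Set} {P : I → Set} (f : I → V × V) →
  (∀ {p q} k l → P p → P q → endpoint k (f p) ≡ endpoint l (f q) → p ≡ q × k ≡ l) →
  ∀ {xs} → All P xs → Unique xs → Unique (endpoints (map f xs))
Unique-endpoints f inj []           []          = []
Unique-endpoints {P = P} f inj {p ∷ xs} (pp ∷ pxs) (p∉xs ∷ u) =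
  (proj₁≢proj₂ ∷ fresh false) ∷ fresh true ∷ Unique-endpoints f inj pxs u
  where
  proj₁≢proj₂ : proj₁ (f p) ≢ proj₂ (f p)
  proj₁≢proj₂ eq with proj₂ (inj false true pp pp eq)
  ... | ()
  fresh : ∀ k → All (endpoint k (f p) ≢_) (endpoints (map f xs))
  fresh k = go xs pxs p∉xs
    where
    go : ∀ ys → All P ys → All (p ≢_) ys → All (endpoint k (f p) ≢_) (endpoints (map f ys))
    go []       []         []          = []
    go (q ∷ ys) (pq ∷ pys) (p≢q ∷ p∉) =
      (p≢q ∘ proj₁ ∘ inj k false pp pq) ∷ (p≢q ∘ proj₁ ∘ inj k true pp pq) ∷ go ys pys p∉

-- The XOR gadget

bitAt : ∀ {k} → (Fin k → Bool) → ℕ → Bool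
bitAt {zero}  x n       = false
bitAt {suc k} x zero    = x F.zero
bitAt {suc k} x (suc n) = bitAt (x ∘ F.suc) n

bitAt-toℕ : ∀ {k} (x : Fin k → Bool) (i : Fin k) → bitAt x (toℕ i) ≡ x i
bitAt-toℕ {suc k} x F.zero    = refl
bitAt-toℕ {suc k} x (F.suc i) = bitAt-toℕ (x ∘ F.suc) i

xorSum : ∀ {k} → (Fin k → Bool) → Bool
xorSum x = VF.foldr _xor_ false x

prefixXor : (ℕ → Bool) → ℕ → Bool
prefixXor bs zero    = bs 0
prefixXor bs (suc n) = prefixXor bs n xor bs (suc n)

prefixXor-suc : ∀ (bs : ℕ → Bool) n → prefixXor bs (suc n) ≡ bs 0 xor prefixXor (bs ∘ suc) n
prefixXor-suc bs zero    = refl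
prefixXor-suc bs (suc n) = trans (cong (_xor bs (suc (suc n))) (prefixXor-suc bs n)) (xor-assoc (bs 0) _ _)

prefixXor-xorSum : ∀ m (x : Fin (suc m) → Bool) → prefixXor (bitAt x) m ≡ xorSum x
prefixXor-xorSum zero    x = sym (xor-identityʳ (x F.zero))
prefixXor-xorSum (suc m) x =
  trans (prefixXor-suc (bitAt x) m) (cong (x F.zero xor_) (prefixXor-xorSum m (x ∘ F.suc)))

isEven : ℕ → Bool
isEven zero    = true
isEven (suc n) = not (isEven n)

isEven-double : ∀ c → isEven (2 * c) ≡ true
isEven-double zero    = refl
isEven-double (suc c) rewrite +-suc c (c + 0) = trans (not-involutive _) (isEven-double c)

-- Whether the vertex a of layer ℓ lies in the vertex cover of the gadget that takes every other vertex
-- along both of its paths, starting with the neighbour of s.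
aInCover : (ℕ → Bool) → ℕ → Bool
aInCover bs zero    = not (bs 0)
aInCover bs (suc n) = not (aInCover bs n) xor bs (suc n)

aInCover-prefixXor : ∀ bs n → aInCover bs n ≡ isEven n xor prefixXor bs n
aInCover-prefixXor bs zero    = refl
aInCover-prefixXor bs (suc n) = begin
  not (aInCover bs n) xor bs (suc n)                    ≡⟨ cong (λ c → not c xor bs (suc n)) (aInCover-prefixXor bs n) ⟩
  not (isEven n xor prefixXor bs n) xor bs (suc n)      ≡⟨ cong (_xor bs (suc n)) (not-distribˡ-xor (isEven n) _) ⟩
  (not (isEven n) xor prefixXor bs n) xor bs (suc n)    ≡⟨ xor-assoc (not (isEven n)) _ _ ⟩
  not (isEven n) xor (prefixXor bs n xor bs (suc n))    ∎
  where open ≡-Reasoning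

module Gadget {m : ℕ} (x : Fin (suc m) → Bool) where

  aIn : Fin m → Bool
  aIn ℓ = aInCover (bitAt x) (toℕ ℓ)

  inCover : GV m → Bool
  inCover s     = false
  inCover (a ℓ) = aIn ℓ
  inCover (b ℓ) = not (aIn ℓ)
  inCover tip   = not (xorSum x)

  aIn-first : ∀ {i} → toℕ i ≡ 0 → aIn i ≡ not (x F.zero)
  aIn-first {i} i≡0 = cong (aInCover (bitAt x)) i≡0

  aIn-next : ∀ {i i'} → toℕ i' ≡ suc (toℕ i) → aIn i' ≡ not (aIn i) xor x (inject₁ i')
  aIn-next {i} {i'} i'≡1+i = begin
    aInCover (bitAt x) (toℕ i')                         ≡⟨ cong (aInCover (bitAt x)) i'≡1+i ⟩
    not (aIn i) xor bitAt x (suc (toℕ i))               ≡⟨ cong (λ n → not (aIn i) xor bitAt x n) i'≡1+i ⟨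
    not (aIn i) xor bitAt x (toℕ i')                    ≡⟨ cong (λ n → not (aIn i) xor bitAt x n) (toℕ-inject₁ i') ⟨
    not (aIn i) xor bitAt x (toℕ (inject₁ i'))          ≡⟨ cong (not (aIn i) xor_) (bitAt-toℕ x (inject₁ i')) ⟩
    not (aIn i) xor x (inject₁ i')                      ∎
    where open ≡-Reasoning

  xorSum-last : isEven m ≡ true → ∀ {i} → suc (toℕ i) ≡ m → xorSum x ≡ aIn i xor x (fromℕ m)
  xorSum-last even {i} 1+i≡m = begin
    xorSum x                                          ≡⟨ prefixXor-xorSum m x ⟨
    prefixXor (bitAt x) m                             ≡⟨ cong (prefixXor (bitAt x)) 1+i≡m ⟨
    prefixXor (bitAt x) (toℕ i) xor bitAt x (suc (toℕ i)) ≡⟨ cong₂ _xor_ (sym aIn≡prefix) (cong (bitAt x) 1+i≡m) ⟩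
    aIn i xor bitAt x m                               ≡⟨ cong (λ n → aIn i xor bitAt x n) (toℕ-fromℕ m) ⟨
    aIn i xor bitAt x (toℕ (fromℕ m))                 ≡⟨ cong (aIn i xor_) (bitAt-toℕ x (fromℕ m)) ⟩
    aIn i xor x (fromℕ m)                             ∎
    where
    open ≡-Reasoning
    i-odd : isEven (toℕ i) ≡ false
    i-odd = trans (sym (not-involutive _)) (cong not (trans (cong isEven 1+i≡m) even))
    aIn≡prefix : aIn i ≡ prefixXor (bitAt x) (toℕ i)
    aIn≡prefix = trans (aInCover-prefixXor (bitAt x) (toℕ i)) (cong (_xor prefixXor (bitAt x) (toℕ i)) i-odd)

  private
    one-of : ∀ {c d} → d ≡ not c → c ≡ true ⊎ d ≡ true
    one-of {true}  _    = inj₁ refl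
    one-of {false} refl = inj₂ refl

    xor-true : ∀ c → c xor true ≡ not c
    xor-true true  = refl
    xor-true false = refl

    last-flip : isEven m ≡ true → ∀ {i c} → suc (toℕ i) ≡ m → x (fromℕ m) ≡ c → xorSum x ≡ aIn i xor c
    last-flip even {i} 1+i≡m x≡c = trans (xorSum-last even 1+i≡m) (cong (aIn i xor_) x≡c)

    next-flip : ∀ {i i' c} → toℕ i' ≡ suc (toℕ i) → x (inject₁ i') ≡ c → aIn i' ≡ not (aIn i) xor c
    next-flip {i} i'≡1+i x≡c = trans (aIn-next i'≡1+i) (cong (not (aIn i) xor_) x≡c)

  inCover-covers : isEven m ≡ true → ∀ {p q} → GEdge x p q → inCover p ≡ true ⊎ inCover q ≡ true
  inCover-covers _    (s-a i i≡0 x≡) = inj₂ (trans (aIn-first i≡0) (cong not x≡))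
  inCover-covers _    (s-b i i≡0 x≡) = inj₂ (cong not (trans (aIn-first i≡0) (cong not x≡)))
  inCover-covers even (a-t i e x≡)   = one-of (cong not (trans (last-flip even e x≡) (xor-identityʳ _)))
  inCover-covers even (b-t i e x≡)   = one-of (cong not (trans (last-flip even e x≡) (xor-true _)))
  inCover-covers _    (a-a i i' e x≡) = one-of (trans (next-flip e x≡) (xor-identityʳ _))
  inCover-covers _    (b-b i i' e x≡) = one-of (cong not (trans (next-flip e x≡) (xor-identityʳ _)))
  inCover-covers _    (a-b i i' e x≡) = one-of (cong not (trans (next-flip e x≡) (trans (xor-true _) (not-involutive _))))
  inCover-covers _    (b-a i i' e x≡) = one-of (trans (next-flip e x≡) (xor-true _))

gadgetVertices : (m : ℕ) → List (GV m)
gadgetVertices m = s ∷ tip ∷ map a (allFin m) ++ map b (allFin m)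

∈-gadgetVertices : ∀ {m} (p : GV m) → p ∈ gadgetVertices m
∈-gadgetVertices s     = here refl
∈-gadgetVertices tip   = there (here refl)
∈-gadgetVertices {m} (a ℓ) = there (there (∈-++⁺ˡ (∈-map⁺ a (∈-allFin ℓ))))
∈-gadgetVertices {m} (b ℓ) = there (there (∈-++⁺ʳ (map a (allFin m)) (∈-map⁺ b (∈-allFin ℓ))))

countᵇ-inCover : ∀ {m} (x : Fin (suc m) → Bool) →
                 countᵇ (Gadget.inCover x) (gadgetVertices m) ≡ bit (not (xorSum x)) + m
countᵇ-inCover {m} x = cong (bit (not (xorSum x)) +_) (begin
  countᵇ inCover (map a (allFin m) ++ map b (allFin m))
    ≡⟨ sumOver-++ (map a (allFin m)) _ _ ⟩
  countᵇ inCover (map a (allFin m)) + countᵇ inCover (map b (allFin m))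
    ≡⟨ cong₂ _+_ (sumOver-map (allFin m) a _) (sumOver-map (allFin m) b _) ⟩
  countᵇ aIn (allFin m) + countᵇ (not ∘ aIn) (allFin m)
    ≡⟨ +-comm (countᵇ aIn (allFin m)) _ ⟩
  countᵇ (not ∘ aIn) (allFin m) + countᵇ aIn (allFin m)
    ≡⟨ countᵇ-not aIn (allFin m) ⟩
  length (allFin m)
    ≡⟨ length-allFin _ ⟩
  m ∎)
  where
  open ≡-Reasoning
  open Gadget x

data GadgetPair (m' : ℕ) : Set where
  first  : GadgetPair m'
  middle : Fin m' → GadgetPair m'
  last   : GadgetPair m'

pairIndex : ∀ {m'} → GadgetPair m' → ℕ
pairIndex first      = 0
pairIndex (middle ℓ) = suc (toℕ ℓ)
pairIndex {m'} last  = suc m'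

pairIndex-injective : ∀ {m'} {g g' : GadgetPair m'} → pairIndex g ≡ pairIndex g' → g ≡ g'
pairIndex-injective {g = first}    {first}     _ = refl
pairIndex-injective {g = middle ℓ} {middle ℓ'} e = cong middle (toℕ-injective (suc-injective e))
pairIndex-injective {g = last}     {last}      _ = refl
pairIndex-injective {g = middle ℓ} {last}      e = ⊥-elim (<-irrefl (suc-injective e) (toℕ<n ℓ))
pairIndex-injective {g = last}     {middle ℓ}  e = ⊥-elim (<-irrefl (sym (suc-injective e)) (toℕ<n ℓ))

-- A matching of the gadget saturating its cover: each cover vertex is matched to its predecessor on its path,
-- which is off the cover since the cover alternates along both paths.
module GadgetMatching {m'} (x : Fin (suc (suc m')) → Bool) where
  open Gadget x

  coverAt uncoverAt : Fin (suc m') → GV (suc m')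
  coverAt   ℓ = if aIn ℓ then a ℓ else b ℓ
  uncoverAt ℓ = if aIn ℓ then b ℓ else a ℓ

  matchedPair : GadgetPair m' → GV (suc m') × GV (suc m')
  matchedPair first      = s , coverAt F.zero
  matchedPair (middle ℓ) = uncoverAt (inject₁ ℓ) , coverAt (F.suc ℓ)
  matchedPair last       = uncoverAt (fromℕ m') , tip

  -- Listing the vertices as s, c₀, n₀, c₁, n₁, …, tip (cℓ/nℓ the vertex of layer ℓ in/off the cover),
  -- the g-th pair occupies places 2g and 2g + 1; this is why the pairs are disjoint.
  slot : GV (suc m') → ℕ × Bool
  slot s     = 0 , false
  slot (a ℓ) = if aIn ℓ then (toℕ ℓ , true) else (suc (toℕ ℓ) , false)
  slot (b ℓ) = if aIn ℓ then (suc (toℕ ℓ) , false) else (toℕ ℓ , true)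
  slot tip   = suc m' , true

  slot-coverAt : ∀ ℓ → slot (coverAt ℓ) ≡ (toℕ ℓ , true)
  slot-coverAt ℓ with aIn ℓ in e
  ... | true  rewrite e = refl
  ... | false rewrite e = refl

  slot-uncoverAt : ∀ ℓ → slot (uncoverAt ℓ) ≡ (suc (toℕ ℓ) , false)
  slot-uncoverAt ℓ with aIn ℓ in e
  ... | true  rewrite e = refl
  ... | false rewrite e = refl

  slot-endpoint : ∀ g k → slot (endpoint k (matchedPair g)) ≡ (pairIndex g , k)
  slot-endpoint first      false = refl
  slot-endpoint first      true  = slot-coverAt F.zero
  slot-endpoint (middle ℓ) false =
    trans (slot-uncoverAt (inject₁ ℓ)) (cong (λ n → suc n , false) (toℕ-inject₁ ℓ))
  slot-endpoint (middle ℓ) true  = slot-coverAt (F.suc ℓ)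
  slot-endpoint last       false =
    trans (slot-uncoverAt (fromℕ m')) (cong (λ n → suc n , false) (toℕ-fromℕ m'))
  slot-endpoint last       true  = refl

  matchedPair-injective : ∀ {g g'} k l → endpoint k (matchedPair g) ≡ endpoint l (matchedPair g') → g ≡ g' × k ≡ l
  matchedPair-injective {g} {g'} k l e with ,-injective (trans (sym (slot-endpoint g k))
                                                      (trans (cong slot e) (slot-endpoint g' l)))
  ... | index≡ , k≡l = pairIndex-injective index≡ , k≡l

  matchedPair-edge : isEven (suc m') ≡ true → ∀ g → (g ≡ last → xorSum x ≡ false) →
                  GEdge x (proj₁ (matchedPair g)) (proj₂ (matchedPair g))
  matchedPair-edge _ first _ with x F.zero in e
  ... | false = s-a F.zero refl e
  ... | true  = s-b F.zero refl e
  matchedPair-edge _ (middle ℓ) _ = edge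
    where
    i i' : Fin (suc m')
    i  = inject₁ ℓ
    i' = F.suc ℓ
    i'≡1+i : toℕ i' ≡ suc (toℕ i)
    i'≡1+i = cong suc (sym (toℕ-inject₁ ℓ))
    edge : GEdge x (uncoverAt i) (coverAt i')
    edge rewrite aIn-next i'≡1+i with aIn i | x (inject₁ i') in e
    ... | true  | true  = b-a i i' i'≡1+i e
    ... | true  | false = b-b i i' i'≡1+i e
    ... | false | true  = a-b i i' i'≡1+i e
    ... | false | false = a-a i i' i'≡1+i e
  matchedPair-edge even last even-parity = edge
    where
    i : Fin (suc m')
    i = fromℕ m'
    1+i≡m : suc (toℕ i) ≡ suc m'
    1+i≡m = cong suc (toℕ-fromℕ m')
    edge : GEdge x (uncoverAt i) tip
    edge with aIn i | x (fromℕ (suc m')) in e | trans (sym (even-parity refl)) (xorSum-last even 1+i≡m)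
    ... | true  | true  | _ = b-t i 1+i≡m e
    ... | false | false | _ = a-t i 1+i≡m e

sides : (N : ℕ) → List (Side N)
sides N = map inj₁ (allFin N) ++ map inj₂ (allFin N)

∈-sides : ∀ {N} (v : Side N) → v ∈ sides N
∈-sides {N} (inj₁ u) = ∈-++⁺ˡ (∈-map⁺ inj₁ (∈-allFin u))
∈-sides {N} (inj₂ u) = ∈-++⁺ʳ (map inj₁ (allFin N)) (∈-map⁺ inj₂ (∈-allFin u))

Unique-sides : ∀ N → Unique (sides N)
Unique-sides N = Unique.++⁺ (Unique.map⁺ inj₁-injective (Unique.allFin⁺ N))
                            (Unique.map⁺ inj₂-injective (Unique.allFin⁺ N))
                            λ (v∈₁ , v∈₂) → left≢right (∈-map⁻ inj₁ v∈₁) (∈-map⁻ inj₂ v∈₂)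
  where
  left≢right : ∀ {v : Side N} →
              (∃ λ u → u ∈ allFin N × v ≡ inj₁ u) → (∃ λ u → u ∈ allFin N × v ≡ inj₂ u) → ⊥
  left≢right (_ , _ , refl) (_ , _ , ())

length-sides : ∀ N → length (sides N) ≡ N + N
length-sides N = trans (length-++ (map inj₁ (allFin N)) {map inj₂ (allFin N)})
  (cong₂ _+_ (trans (length-map inj₁ (allFin N)) (length-allFin N))
             (trans (length-map inj₂ (allFin N)) (length-allFin N)))

module _ {N r t m : ℕ} (rs : RSGraph N r t) (j : Fin t) where
  open RSGraph rs

  unmatched-count : countᵇ (not ∘ yv {m = m} rs j) (sides N) + (r + r) ≡ N + N
  unmatched-count = begin
    countᵇ (not ∘ y) (sides N) + (r + r)
      ≡⟨ cong (_+ (r + r)) (trans (sumOver-++ (map inj₁ (allFin N)) _ _)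
                                  (cong₂ _+_ (sumOver-map (allFin N) inj₁ _) (sumOver-map (allFin N) inj₂ _))) ⟩
    (countᵇ (not ∘ yˡ) (allFin N) + countᵇ (not ∘ yʳ) (allFin N)) + (r + r)
      ≡⟨ +-interchange (countᵇ (not ∘ yˡ) (allFin N)) (countᵇ (not ∘ yʳ) (allFin N)) r r ⟩
    (countᵇ (not ∘ yˡ) (allFin N) + r) + (countᵇ (not ∘ yʳ) (allFin N) + r)
      ≡⟨ cong₂ _+_ (countᵇ-not-inImage (proj₁ ∘ M j) (injL j)) (countᵇ-not-inImage (proj₂ ∘ M j) (injR j)) ⟩
    N + N ∎
    where
    open ≡-Reasoning
    y : Side N → Bool
    y = yv {m = m} rs j
    yˡ yʳ : Fin N → Bool
    yˡ u = y (inj₁ u)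
    yʳ u = y (inj₂ u)

  -- One vertex per gadget layer, plus each final vertex not matched by M j⋆.
  coverSize : ℕ
  coverSize = countᵇ (not ∘ yv {m = m} rs j) (sides N) + (N + N) * m

  sumOver-sides≡coverSize : (f : Side N → ℕ) → (∀ v → f v ≡ bit (not (yv {m = m} rs j v)) + m) →
                            sumOver (sides N) f ≡ coverSize
  sumOver-sides≡coverSize f f≡ = begin
    sumOver (sides N) f
      ≡⟨ sumOver-cong (sides N) f≡ ⟩
    sumOver (sides N) (λ v → bit (not (yv {m = m} rs j v)) + m)
      ≡⟨ sumOver-+ (sides N) _ _ ⟩
    countᵇ (not ∘ yv {m = m} rs j) (sides N) + sumOver (sides N) (λ _ → m)
      ≡⟨ cong (countᵇ (not ∘ yv {m = m} rs j) (sides N) +_) (trans (sumOver-const (sides N) m) (cong (_* m) (length-sides N))) ⟩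
    coverSize ∎
    where open ≡-Reasoning

module _ {N r t m : ℕ} (rs : RSGraph N r t) (j : Fin t) (x : Side N → Fin (suc m) → Bool)
         (valid≡ : valid rs j x ≡ true) where
  open RSGraph rs

  private
    consistent? : (side : Fin N → Side N) → Dec (∀ u → xorSum (x (side u)) ≡ yv {m = m} rs j (side u))
    consistent? side = all? (λ u → xorSum (x (side u)) Bool.≟ yv {m = m} rs j (side u))

    consistent : T ⌊ consistent? inj₁ ⌋ × T ⌊ consistent? inj₂ ⌋
    consistent = Equivalence.to (T-∧ {⌊ consistent? inj₁ ⌋}) (Equivalence.from T-≡ valid≡)

  xorSum-valid : ∀ v → xorSum (x v) ≡ yv {m = m} rs j v
  xorSum-valid (inj₁ u) = toWitness (proj₁ consistent) u
  xorSum-valid (inj₂ u) = toWitness (proj₂ consistent) u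

  inCover : Vtx {m = m} rs → Bool
  inCover (v , p) = Gadget.inCover (x v) p

  countᵇ-inCover-all : countᵇ inCover (cartesianProduct (sides N) (gadgetVertices m)) ≡ coverSize {m = m} rs j
  countᵇ-inCover-all =
    trans (sumOver-cartesianProduct (sides N) (gadgetVertices m) _)
          (sumOver-sides≡coverSize rs j _ (λ v → trans (countᵇ-inCover (x v)) (cong (λ c → bit (not c) + m) (xorSum-valid v))))

  module _ (S : Fin t → Fin r → Bool) (m-even : isEven m ≡ true) where

    inCover-covers-G∖M : ∀ {u v} → GminusM rs j x S u v → inCover u ≡ true ⊎ inCover v ≡ true
    inCover-covers-G∖M (gadget e , _) = Gadget.inCover-covers _ m-even e
    inCover-covers-G∖M (rsEdge j' i _ , not-special)
      with yv {m = m} rs j (inj₁ (proj₁ (M j' i))) in matchedˡ | yv {m = m} rs j (inj₂ (proj₂ (M j' i))) in matchedʳ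
    ... | false | _     = inj₁ (cong not (trans (xorSum-valid _) matchedˡ))
    ... | true  | false = inj₂ (cong not (trans (xorSum-valid _) matchedʳ))
    ... | true  | true  with isYes-witness (any? _) matchedˡ | isYes-witness (any? _) matchedʳ
    ...   | i₁ , e₁ | i₂ , e₂ with induced {j} {j'} {i} {i₁} {i₂} (sym e₁) (sym e₂)
    ...     | refl = ⊥-elim (not-special (i , refl , refl))

    matching-G∖M≤coverSize : ∀ ms → IsMatching (GminusM rs j x S) ms → length ms ≤ coverSize {m = m} rs j
    matching-G∖M≤coverSize ms matching = subst (length ms ≤_) countᵇ-inCover-all
      (matching≤cover inCover inCover-covers-G∖M (cartesianProduct (sides N) (gadgetVertices m))
        (λ (v , p) → ∈-cartesianProduct⁺ (∈-sides v) (∈-gadgetVertices p)) ms matching)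

allPairs : (m' : ℕ) → List (GadgetPair m')
allPairs m' = last ∷ first ∷ map middle (allFin m')

Unique-allPairs : ∀ m' → Unique (allPairs m')
Unique-allPairs m' =
  ((λ ()) ∷ All.map⁺ (All.tabulate (λ _ ()))) ∷ All.map⁺ (All.tabulate (λ _ ())) ∷
  Unique.map⁺ (λ { refl → refl }) (Unique.allFin⁺ m')

module _ {N r t m' : ℕ} (rs : RSGraph N r t) (j : Fin t) (x : Side N → Fin (suc (suc m')) → Bool)
         (S : Fin t → Fin r → Bool) (valid≡ : valid rs j x ≡ true) (m-even : isEven (suc m') ≡ true) where
  open RSGraph rs

  private
    V : Set
    V = Vtx {m = suc m'} rs
    matched : Side N → Bool
    matched = yv {m = suc m'} rs j
    pairAt : Side N → GadgetPair m' → GV (suc m') × GV (suc m')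
    pairAt v = GadgetMatching.matchedPair (x v)

  data MatchingEdge : Set where
    gadgetEdge  : Side N × GadgetPair m' → MatchingEdge
    specialEdge : Fin r → MatchingEdge

  -- A final vertex matched by M j⋆ is left for its special edge.
  keepPair : Side N × GadgetPair m' → Bool
  keepPair (v , last)       = not (matched v)
  keepPair (v , first)      = true
  keepPair (v , middle _)   = true

  Kept : MatchingEdge → Set
  Kept (gadgetEdge vg) = T (keepPair vg)
  Kept (specialEdge i)  = T (S j i)

  keptPairs : List (Side N × GadgetPair m')
  keptPairs = filterᵇ keepPair (cartesianProduct (sides N) (allPairs m'))

  keptEdges : List MatchingEdge
  keptEdges = map gadgetEdge keptPairs ++ map specialEdge (filterᵇ (S j) (allFin r))

  edge : MatchingEdge → V × V
  edge (gadgetEdge (v , g)) = (v , proj₁ (pairAt v g)) , (v , proj₂ (pairAt v g))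
  edge (specialEdge i)      = (inj₁ (proj₁ (M j i)) , tip) , (inj₂ (proj₂ (M j i)) , tip)

  All-Kept : All Kept keptEdges
  All-Kept = All.++⁺ (All.map⁺ {f = gadgetEdge} (All.all-filter (T? ∘ keepPair) (cartesianProduct (sides N) (allPairs m'))))
                     (All.map⁺ {f = specialEdge} (All.all-filter (T? ∘ S j) (allFin r)))

  Unique-keptEdges : Unique keptEdges
  Unique-keptEdges = Unique.++⁺
    (Unique.map⁺ (λ { refl → refl })
      (Unique.filter⁺ (T? ∘ keepPair) (Unique.cartesianProduct⁺ (Unique-sides N) (Unique-allPairs m'))))
    (Unique.map⁺ (λ { refl → refl }) (Unique.filter⁺ (T? ∘ S j) (Unique.allFin⁺ r)))
    gadget∩special≡∅
    where
    gadget∩special≡∅ : ∀ {e} → e ∈ map gadgetEdge keptPairs × e ∈ map specialEdge (filterᵇ (S j) (allFin r)) → ⊥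
    gadget∩special≡∅ (e∈ , e∈') with ∈-map⁻ gadgetEdge e∈ | ∈-map⁻ specialEdge e∈'
    ... | _ , _ , refl | _ , _ , ()

  private
    endpoint-gadgetEdge : ∀ v g k → endpoint k (edge (gadgetEdge (v , g))) ≡ (v , endpoint k (pairAt v g))
    endpoint-gadgetEdge v g false = refl
    endpoint-gadgetEdge v g true  = refl

    endpoint-specialEdge : ∀ i k → ∃ λ v → endpoint k (edge (specialEdge i)) ≡ (v , tip) × matched v ≡ true
    endpoint-specialEdge i false = _ , refl , isYes-true (any? _) (i , refl)
    endpoint-specialEdge i true  = _ , refl , isYes-true (any? _) (i , refl)

    gadget≢special : ∀ {v g} i k l → Kept (gadgetEdge (v , g)) →
                     endpoint k (edge (gadgetEdge (v , g))) ≢ endpoint l (edge (specialEdge i))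
    gadget≢special {v} {g} i k l kept e with endpoint-specialEdge i l
    ... | w , e' , w-matched =
      not-matched (cong proj₁ same) (proj₁ (GadgetMatching.matchedPair-injective (x v) k true (cong proj₂ same)))
      where
      same : (v , endpoint k (pairAt v g)) ≡ (w , tip)
      same = trans (sym (endpoint-gadgetEdge v g k)) (trans e e')
      not-matched : v ≡ w → g ≡ last → ⊥
      not-matched refl refl = subst (T ∘ not) w-matched kept

  edge-injective : ∀ {e e'} k l → Kept e → Kept e' → endpoint k (edge e) ≡ endpoint l (edge e') → e ≡ e' × k ≡ l
  edge-injective {gadgetEdge (v , g)} {gadgetEdge (w , g')} k l _ _ eq
    with same ← trans (sym (endpoint-gadgetEdge v g k)) (trans eq (endpoint-gadgetEdge w g' l))
    with refl ← cong proj₁ same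
    with refl , k≡l ← GadgetMatching.matchedPair-injective (x v) k l (cong proj₂ same)
    = refl , k≡l
  edge-injective {gadgetEdge (v , g)} {specialEdge i} k l kept _ eq = ⊥-elim (gadget≢special {v} {g} i k l kept eq)
  edge-injective {specialEdge i} {gadgetEdge (v , g)} k l _ kept eq = ⊥-elim (gadget≢special {v} {g} i l k kept (sym eq))
  edge-injective {specialEdge i} {specialEdge i'} false false _ _ eq
    with refl ← injL j (inj₁-injective (cong proj₁ eq)) = refl , refl
  edge-injective {specialEdge i} {specialEdge i'} true  true  _ _ eq
    with refl ← injR j (inj₂-injective (cong proj₁ eq)) = refl , refl
  edge-injective {specialEdge i} {specialEdge i'} false true  _ _ eq with () ← cong proj₁ eq
  edge-injective {specialEdge i} {specialEdge i'} true  false _ _ eq with () ← cong proj₁ eq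

  edge-adjacent : ∀ e → Kept e → Adj (GE rs x S) (proj₁ (edge e)) (proj₂ (edge e))
  edge-adjacent (gadgetEdge (v , g)) kept = inj₁ (gadget (GadgetMatching.matchedPair-edge (x v) m-even g last-allowed))
    where
    last-allowed : g ≡ last → xorSum (x v) ≡ false
    last-allowed refl = trans (xorSum-valid rs j x valid≡ v) (Equivalence.to T-not-≡ kept)
  edge-adjacent (specialEdge i) kept = inj₁ (rsEdge j i (Equivalence.to T-≡ kept))

  keptEdges-matching : IsMatching (GE rs x S) (map edge keptEdges)
  keptEdges-matching = All.map⁺ (All.map (λ {e} → edge-adjacent e) All-Kept)
                     , Unique-endpoints edge edge-injective All-Kept Unique-keptEdges

  length-keptEdges : length (map edge keptEdges) ≡ coverSize {m = suc m'} rs j + countᵇ (S j) (allFin r)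
  length-keptEdges = begin
    length (map edge keptEdges)
      ≡⟨ length-map edge keptEdges ⟩
    length (map gadgetEdge keptPairs ++ map specialEdge (filterᵇ (S j) (allFin r)))
      ≡⟨ length-++ (map gadgetEdge keptPairs) ⟩
    length (map gadgetEdge keptPairs) + length (map specialEdge (filterᵇ (S j) (allFin r)))
      ≡⟨ cong₂ _+_ (length-map gadgetEdge keptPairs) (length-map specialEdge (filterᵇ (S j) (allFin r))) ⟩
    length keptPairs + length (filterᵇ (S j) (allFin r))
      ≡⟨ cong₂ _+_ (length-filterᵇ keepPair (cartesianProduct (sides N) (allPairs m'))) (length-filterᵇ (S j) (allFin r)) ⟩
    countᵇ keepPair (cartesianProduct (sides N) (allPairs m')) + countᵇ (S j) (allFin r)
      ≡⟨ cong (_+ countᵇ (S j) (allFin r)) (trans (sumOver-cartesianProduct (sides N) (allPairs m') _)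
                                                   (sumOver-sides≡coverSize rs j _ (λ v → cong (λ n → _ + suc n) (middles v)))) ⟩
    coverSize {m = suc m'} rs j + countᵇ (S j) (allFin r) ∎
    where
    open ≡-Reasoning
    middles : ∀ v → countᵇ (λ g → keepPair (v , g)) (map middle (allFin m')) ≡ m'
    middles v = trans (sumOver-map (allFin m') middle _)
                    (trans (sumOver-const (allFin m') 1) (trans (*-identityʳ _) (length-allFin m')))

  coverSize+kept≤μ : ∀ {μ} → IsMaxMatchingSize (GE rs x S) μ → coverSize {m = suc m'} rs j + countᵇ (S j) (allFin r) ≤ μ
  coverSize+kept≤μ (_ , maximal) = subst (_≤ _) length-keptEdges (maximal (map edge keptEdges) keptEdges-matching)

-- Averaging over the dropped edges

length≡sumOver-1 : {A : Set} (xs : List A) → length xs ≡ sumOver xs (λ _ → 1)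
length≡sumOver-1 xs = sym (trans (sumOver-const xs 1) (*-identityʳ _))

length-allFuns : {A : Set} (n : ℕ) (xs : List A) → length (allFuns (suc n) xs) ≡ length xs * length (allFuns n xs)
length-allFuns n xs = begin
  length (allFuns (suc n) xs)
    ≡⟨ length≡sumOver-1 (allFuns (suc n) xs) ⟩
  sumOver (concatMap (λ y → map (y VF.∷_) (allFuns n xs)) xs) (λ _ → 1)
    ≡⟨ sumOver-concatMap xs _ _ ⟩
  sumOver xs (λ y → sumOver (map (y VF.∷_) (allFuns n xs)) (λ _ → 1))
    ≡⟨ sumOver-cong xs (λ y → trans (sumOver-map (allFuns n xs) _ _) (sym (length≡sumOver-1 (allFuns n xs)))) ⟩
  sumOver xs (λ _ → length (allFuns n xs))
    ≡⟨ sumOver-const xs _ ⟩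
  length xs * length (allFuns n xs) ∎
  where open ≡-Reasoning

sumOver-allFuns-coordinate : {A : Set} {t : ℕ} (j : Fin (suc t)) (xs : List A) (h : A → ℕ) →
  sumOver (allFuns (suc t) xs) (λ S → h (S j)) ≡ length (allFuns t xs) * sumOver xs h
sumOver-allFuns-coordinate {t = t} j xs h = begin
  sumOver (allFuns (suc t) xs) (λ S → h (S j))
    ≡⟨ sumOver-concatMap xs _ _ ⟩
  sumOver xs (λ y → sumOver (map (y VF.∷_) (allFuns t xs)) (λ S → h (S j)))
    ≡⟨ sumOver-cong xs (λ y → sumOver-map (allFuns t xs) (y VF.∷_) _) ⟩
  sumOver xs (λ y → sumOver (allFuns t xs) (λ S → h ((y VF.∷ S) j)))
    ≡⟨ coordinate j ⟩
  length (allFuns t xs) * sumOver xs h ∎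
  where
  open ≡-Reasoning
  coordinate : ∀ {t} (j : Fin (suc t)) → sumOver xs (λ y → sumOver (allFuns t xs) (λ S → h ((y VF.∷ S) j)))
                                          ≡ length (allFuns t xs) * sumOver xs h
  coordinate {t} F.zero = trans (sumOver-cong xs (λ y → sumOver-const (allFuns t xs) (h y))) (sumOver-*ˡ xs (length (allFuns t xs)) h)
  coordinate {suc t} (F.suc j) = begin
    sumOver xs (λ _ → sumOver (allFuns (suc t) xs) (λ S → h (S j)))
      ≡⟨ sumOver-const xs _ ⟩
    length xs * sumOver (allFuns (suc t) xs) (λ S → h (S j))
      ≡⟨ cong (length xs *_) (sumOver-allFuns-coordinate j xs h) ⟩
    length xs * (length (allFuns t xs) * sumOver xs h)
      ≡⟨ *-assoc (length xs) _ _ ⟨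
    length xs * length (allFuns t xs) * sumOver xs h
      ≡⟨ cong (_* sumOver xs h) (length-allFuns t xs) ⟨
    length (allFuns (suc t) xs) * sumOver xs h ∎

countᵇ-∷ : ∀ {r} (y : Bool) (g : Fin r → Bool) → countᵇ (y VF.∷ g) (allFin (suc r)) ≡ bit y + countᵇ g (allFin r)
countᵇ-∷ {r} y g = cong (bit y +_) (begin
  countᵇ (y VF.∷ g) (tabulate F.suc)           ≡⟨ cong (countᵇ (y VF.∷ g)) (map-tabulate id F.suc) ⟨
  countᵇ (y VF.∷ g) (map F.suc (allFin r))     ≡⟨ sumOver-map (allFin r) F.suc _ ⟩
  countᵇ g (allFin r)                          ∎)
  where open ≡-Reasoning

sumOver-countᵇ-allFuns : ∀ r → 2 * sumOver (allFuns r bools) (λ y → countᵇ y (allFin r)) ≡ r * length (allFuns r bools)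
sumOver-countᵇ-allFuns zero    = refl
sumOver-countᵇ-allFuns (suc r) = begin
  2 * sumOver (allFuns (suc r) bools) count
    ≡⟨ cong (2 *_) (sumOver-concatMap bools (λ y → map (y VF.∷_) A) count) ⟩
  2 * (sumOver (map (false VF.∷_) A) count + (sumOver (map (true VF.∷_) A) count + 0))
    ≡⟨ cong (2 *_) (cong₂ (λ f t → f + (t + 0)) (with-first false) (with-first true)) ⟩
  2 * ((length A * 0 + C) + ((length A * 1 + C) + 0))
    ≡⟨ solve 2 (λ a c → con 2 :* ((a :* con 0 :+ c) :+ ((a :* con 1 :+ c) :+ con 0)) := con 2 :* a :+ con 2 :* (con 2 :* c))
             refl (length A) C ⟩
  2 * length A + 2 * (2 * C)
    ≡⟨ cong (λ c → 2 * length A + 2 * c) (sumOver-countᵇ-allFuns r) ⟩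
  2 * length A + 2 * (r * length A)
    ≡⟨ solve 2 (λ r a → con 2 :* a :+ con 2 :* (r :* a) := (con 1 :+ r) :* (con 2 :* a)) refl r (length A) ⟩
  suc r * (2 * length A)
    ≡⟨ cong (suc r *_) (length-allFuns r bools) ⟨
  suc r * length (allFuns (suc r) bools) ∎
  where
  open ≡-Reasoning
  open +-*-Solver
  A : List (Fin r → Bool)
  A = allFuns r bools
  count : (Fin (suc r) → Bool) → ℕ
  count y = countᵇ y (allFin (suc r))
  C : ℕ
  C = sumOver A (λ y → countᵇ y (allFin r))
  with-first : ∀ y → sumOver (map (y VF.∷_) A) count ≡ length A * bit y + C
  with-first y = begin
    sumOver (map (y VF.∷_) A) count              ≡⟨ sumOver-map A (y VF.∷_) count ⟩
    sumOver A (λ g → count (y VF.∷ g))            ≡⟨ sumOver-cong A (countᵇ-∷ y) ⟩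
    sumOver A (λ g → bit y + countᵇ g (allFin r)) ≡⟨ sumOver-+ A _ _ ⟩
    sumOver A (λ _ → bit y) + C                   ≡⟨ cong (_+ C) (sumOver-const A (bit y)) ⟩
    length A * bit y + C                          ∎

sumOver-kept : ∀ {t r} (j : Fin t) →
  2 * sumOver (allFuns t (allFuns r bools)) (λ S → countᵇ (S j) (allFin r)) ≡ r * length (allFuns t (allFuns r bools))
sumOver-kept {suc t} {r} j = begin
  2 * sumOver (allFuns (suc t) X) (λ S → countᵇ (S j) (allFin r))
    ≡⟨ cong (2 *_) (sumOver-allFuns-coordinate j X (λ y → countᵇ y (allFin r))) ⟩
  2 * (length (allFuns t X) * C)
    ≡⟨ *-swapˡ 2 (length (allFuns t X)) C ⟩
  length (allFuns t X) * (2 * C)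
    ≡⟨ cong (length (allFuns t X) *_) (sumOver-countᵇ-allFuns r) ⟩
  length (allFuns t X) * (r * length X)
    ≡⟨ *-swapˡ (length (allFuns t X)) r (length X) ⟩
  r * (length (allFuns t X) * length X)
    ≡⟨ cong (r *_) (trans (*-comm (length (allFuns t X)) (length X)) (sym (length-allFuns t X))) ⟩
  r * length (allFuns (suc t) X) ∎
  where
  open ≡-Reasoning
  X : List (Fin r → Bool)
  X = allFuns r bools
  C : ℕ
  C = sumOver X (λ y → countᵇ y (allFin r))

expectation-lower-bound : ∀ {N r t m} (rs : RSGraph N r t) (B : ℕ)
  (μG : Fin t → (Side N → Fin (suc m) → Bool) → (Fin t → Fin r → Bool) → ℕ) →
  (∀ j x S → valid rs j x ≡ true → B + countᵇ (S j) (allFin r) ≤ μG j x S) →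
  (2 * B + r) * expDen {m = m} rs ≤ 2 * expNum rs μG
expectation-lower-bound {N} {r} {t} {m} rs B μG bound =
  *-sumOver-mono (allFin t) K 2 λ j →
  *-sumOver-mono Xs K 2 λ xL →
  *-sumOver-mono Xs K 2 λ xR →
  given-outcome j [ xL , xR ]
  where
  K : ℕ
  K = 2 * B + r
  Xs : List (Fin N → Fin (suc m) → Bool)
  Xs = allFuns N (allFuns (suc m) bools)
  Ss : List (Fin t → Fin r → Bool)
  Ss = allFuns t (allFuns r bools)
  given-outcome : ∀ j x → K * sumOver Ss (λ S → if valid rs j x then 1 else 0)
                        ≤ 2 * sumOver Ss (λ S → if valid rs j x then μG j x S else 0)
  given-outcome j x with valid rs j x in valid≡
  ... | false = subst (_≤ 2 * sumOver Ss (λ _ → 0)) (sym K*0≡0) z≤n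
    where
    K*0≡0 : K * sumOver Ss (λ _ → 0) ≡ 0
    K*0≡0 = trans (cong (K *_) (trans (sumOver-const Ss 0) (*-zeroʳ (length Ss)))) (*-zeroʳ K)
  ... | true  = begin
    K * sumOver Ss (λ _ → 1)
      ≡⟨ cong (K *_) (length≡sumOver-1 Ss) ⟨
    (2 * B + r) * length Ss
      ≡⟨ *-distribʳ-+ (length Ss) (2 * B) r ⟩
    2 * B * length Ss + r * length Ss
      ≡⟨ cong₂ _+_ (trans (*-assoc 2 B _) (cong (2 *_) (trans (*-comm B _) (sym (sumOver-const Ss B)))))
                   (sym (sumOver-kept j)) ⟩
    2 * sumOver Ss (λ _ → B) + 2 * sumOver Ss (λ S → countᵇ (S j) (allFin r))
      ≡⟨ *-distribˡ-+ 2 (sumOver Ss (λ _ → B)) _ ⟨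
    2 * (sumOver Ss (λ _ → B) + sumOver Ss (λ S → countᵇ (S j) (allFin r)))
      ≡⟨ cong (2 *_) (sumOver-+ Ss (λ _ → B) (λ S → countᵇ (S j) (allFin r))) ⟨
    2 * sumOver Ss (λ S → B + countᵇ (S j) (allFin r))
      ≤⟨ *-monoʳ-≤ 2 (sumOver-mono Ss (λ S → bound j x S valid≡)) ⟩
    2 * sumOver Ss (μG j x) ∎
    where open ≤-Reasoning

-- The parameters N = 3r and k = 2c + 1

bound≡coverSize : ∀ {r t m} (rs : RSGraph (3 * r) r t) j →
                  (3 * r ∸ r) * (2 * suc m) + 2 * r * m ≡ coverSize {m = m} rs j
bound≡coverSize {r} {m = m} rs j = begin
  (3 * r ∸ r) * (2 * suc m) + 2 * r * m
    ≡⟨ cong (λ n → n * (2 * suc m) + 2 * r * m) 3r∸r≡2r ⟩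
  (r + r) * (2 * suc m) + 2 * r * m
    ≡⟨ solve 2 (λ r m → (r :+ r) :* (con 2 :* (con 1 :+ m)) :+ con 2 :* r :* m
                      := ((r :+ r) :+ (r :+ r)) :+ (con 3 :* r :+ con 3 :* r) :* m) refl r m ⟩
  ((r + r) + (r + r)) + (3 * r + 3 * r) * m
    ≡⟨ cong (_+ (3 * r + 3 * r) * m) unmatched≡4r ⟨
  coverSize {m = m} rs j ∎
  where
  open ≡-Reasoning
  open +-*-Solver
  3r∸r≡2r : 3 * r ∸ r ≡ r + r
  3r∸r≡2r = trans (cong (_∸ r) (solve 1 (λ r → con 3 :* r := (r :+ r) :+ r) refl r)) (m+n∸n≡m (r + r) r)
  unmatched≡4r : countᵇ (not ∘ yv {m = m} rs j) (sides (3 * r)) ≡ (r + r) + (r + r)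
  unmatched≡4r = +-cancelʳ-≡ (r + r) _ _
    (trans (unmatched-count {m = m} rs j) (solve 1 (λ r → con 3 :* r :+ con 3 :* r := ((r :+ r) :+ (r :+ r)) :+ (r :+ r)) refl r))

IsCeilLog43-zero : ∀ {r} → IsCeilLog43 (3 * r) 0 → r ≡ 0
IsCeilLog43-zero {zero}  _          = refl
IsCeilLog43-zero {suc r} (3r≤1 , _) with s≤s () ← ≤-trans (m≤m*n 3 (suc r)) (subst (_≤ 1) (*-identityʳ (3 * suc r)) 3r≤1)

-- For c = 0 the gadget has no edges at all, but then N = 0.
bound+kept≤μ : ∀ {r t} c → IsCeilLog43 (3 * r) c → (rs : RSGraph (3 * r) r t) →
  ∀ j (x : Side (3 * r) → Fin (suc (2 * c)) → Bool) S → valid rs j x ≡ true →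
  ∀ {μ} → IsMaxMatchingSize (GE rs x S) μ →
  (3 * r ∸ r) * (2 * suc (2 * c)) + 2 * r * (2 * c) + countᵇ (S j) (allFin r) ≤ μ
bound+kept≤μ {r} zero ceil rs j x S valid≡ max with refl ← IsCeilLog43-zero {r} ceil = z≤n
bound+kept≤μ (suc c) ceil rs j x S valid≡ {μ} max =
  subst (λ B → B + countᵇ (S j) (allFin _) ≤ μ) (sym (bound≡coverSize {m = 2 * suc c} rs j))
        (coverSize+kept≤μ {m' = c + suc (c + 0)} rs j x S valid≡ (isEven-double (suc c)) max)

lemma5p7 : (N r t c : ℕ) → N ≡ 3 * r → 1 ≤ t → IsCeilLog43 N c →
    (rs : RSGraph N r t) →
    ((μG : Fin t → (Side N → Fin (suc (2 * c)) → Bool) → (Fin t → Fin r → Bool) → ℕ) →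
      (∀ j x S → valid rs j x ≡ true → IsMaxMatchingSize (GE rs x S) (μG j x S)) →
      (2 * ((N ∸ r) * (2 * suc (2 * c)) + 2 * r * (2 * c)) + r) * expDen {m = 2 * c} rs
        ≤ 2 * expNum rs μG)
    ×
    (∀ j (x : Side N → Fin (suc (2 * c)) → Bool) S → valid rs j x ≡ true →
      ∀ (ms : List (Vtx {m = 2 * c} rs × Vtx {m = 2 * c} rs)) → IsMatching (GminusM rs j x S) ms →
      length ms ≤ (N ∸ r) * (2 * suc (2 * c)) + 2 * r * (2 * c))
lemma5p7 .(3 * r) r t c refl _ ceil rs =
    (λ μG max → expectation-lower-bound rs _ μG λ j x S valid≡ → bound+kept≤μ c ceil rs j x S valid≡ (max j x S valid≡))
  , λ j x S valid≡ ms matching →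
      subst (length ms ≤_) (sym (bound≡coverSize {m = 2 * c} rs j))
            (matching-G∖M≤coverSize rs j x valid≡ S (isEven-double c) ms matching)
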